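{- For any triple $\boldsymbol\tau=(\mathbf k,\mathbf p,\mathbf q)$, with dual triple $\boldsymbol\tau^*=(\mathbf k,\mathbf q,\mathbf p)$, we have $w(\boldsymbol\tau^*)=w(\boldsymbol\tau)^{ -1}$.
   Context: Write $\bar a$ for $-a$. A signed permutation is a bijection $w$ of $\mathbb Z$ with $w(\bar i)=\overline{w(i)}$ for all $i$ and $w(i)=i$ for $|i|$ large; these form a group under composition. A triple is $\boldsymbol\tau=(\mathbf k,\mathbf p,\mathbf q)$ of $s$-tuples of positive integers with $0<k_1<\cdots<k_s$, $p_1\ge\cdots\ge p_s>0$, $q_1\ge\cdots\ge q_s>0$, and $p_i-p_{i+1}+q_i-q_{i+1}\ge k_{i+1}-k_i$ for $1\le i\le s-1$ (this condition is symmetric in $\mathbf p,\mathbf q$, so $(\mathbf k,\mathbf q,\mathbf p)$ is also a triple). The signed permutation $w(\boldsymbol\tau)$ is built on positions $1,2,\dots,n$ ($n$ large enough): for $i=1,\dots,s$ in turn (with $k_0=0$), take the $k_i-k_{i-1}$ smallest positive integers $c\ge q_i$ not yet used, and place their negatives $\bar c$ in increasing order into the first $k_i-k_{i-1}$ vacant positions that are $\ge p_i$ (left to right), marking these $c$ as used; finally fill the remaining vacant positions, left to right, with the unused positive integers in increasing order. -}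

module Defs where

open import Data.Nat using (ℕ; zero; suc; _+_; _∸_; _≤_; _<_; _≤ᵇ_; _≡ᵇ_)
open import Data.Bool using (Bool; true; false; if_then_else_; not)
open import Data.Integer using (ℤ; +_; -[1+_]; -_)
open import Data.List using (List; []; _∷_; length; map; applyUpTo; replicate)
open import Data.Maybe using (Maybe; just; nothing)
open import Data.Product using (_×_; _,_; proj₁; proj₂)
open import Data.Unit using (⊤)

-- Triples.  A triple (k, p, q) of s-tuples is represented as the list
-- of its s columns (k_i , p_i , q_i), i = 1 .. s.

Column : Set
Column = ℕ × ℕ × ℕ

IsTriple : List Column → Set
IsTriple [] = ⊤
IsTriple ((k , p , q) ∷ []) = (0 < k) × (0 < p) × (0 < q)
IsTriple ((k , p , q) ∷ (k' , p' , q') ∷ rest) =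
  (0 < k) × (0 < p) × (0 < q) ×
  (k < k') × (p' ≤ p) × (q' ≤ q) ×
  (k' ∸ k ≤ (p ∸ p') + (q ∸ q')) ×
  IsTriple ((k' , p' , q') ∷ rest)

dual : List Column → List Column
dual = map (λ { (k , p , q) → (k , q , p) })

-- The construction of w(τ) on positions 1 .. n.
-- A board is a list of length n; its j-th entry (0-based) is the value at
-- position j+1, `nothing` meaning vacant.

Board : Set
Board = List (Maybe ℤ)

mem : ℕ → List ℕ → Bool
mem c [] = false
mem c (d ∷ ds) = if c ≡ᵇ d then true else mem c ds

unusedOf : List ℕ → List ℕ → List ℕ
unusedOf used [] = []
unusedOf used (c ∷ cs) = if mem c used then unusedOf used cs else c ∷ unusedOf used cs

take : ℕ → List ℕ → List ℕ
take zero xs = []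
take (suc m) [] = []
take (suc m) (x ∷ xs) = x ∷ take m xs

-- the m smallest positive integers c ≥ q not in `used`
-- (the range q, q+1, ..., q + |used| + m - 1 always contains m of them)
chooseVals : ℕ → ℕ → List ℕ → List ℕ
chooseVals m q used = take m (unusedOf used (applyUpTo (λ j → q + j) (length used + m)))

fillFrom : ℕ → ℕ → List ℤ → Board → Board
fillFrom pos p [] b = b
fillFrom pos p (v ∷ vs) [] = []
fillFrom pos p (v ∷ vs) (just x ∷ b) = just x ∷ fillFrom (suc pos) p (v ∷ vs) b
fillFrom pos p (v ∷ vs) (nothing ∷ b) =
  if p ≤ᵇ pos
  then just v ∷ fillFrom (suc pos) p vs b
  else nothing ∷ fillFrom (suc pos) p (v ∷ vs) b

-- run the steps i = 1 .. s; `prev` is k_{i-1} (k_0 = 0)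
steps : ℕ → List Column → Board × List ℕ → Board × List ℕ
steps prev [] st = st
steps prev ((k , p , q) ∷ rest) (b , used) =
  let cs = chooseVals (k ∸ prev) q used
  in steps k rest (fillFrom 1 p (map (λ c → - (+ c)) cs) b , used Data.List.++ cs)

oneLine : ℕ → List Column → Board
oneLine n τ =
  let st   = steps 0 τ (replicate n nothing , [])
      b    = proj₁ st
      used = proj₂ st
      rest = unusedOf used (applyUpTo suc (n + length used))
  in fillFrom 1 0 (map +_ rest) b

at : ℕ → Board → ℤ → ℤ
at j [] d = d
at zero (nothing ∷ b) d = d
at zero (just x ∷ b) d = x
at (suc j) (_ ∷ b) d = at j b d

-- w(τ) (built on positions 1 .. n) as a map ℤ → ℤ:
-- w(i) from the one-line notation for 1 ≤ i ≤ n, w(i) = i for i > n,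
-- w(0) = 0 and w(ī) = -(w(i)).
wₙ : ℕ → List Column → ℤ → ℤ
wₙ n τ (+ zero) = + zero
wₙ n τ (+ suc i) = at i (oneLine n τ) (+ suc i)
wₙ n τ -[1+ i ] = - (at i (oneLine n τ) (+ suc i))

{-# OPTIONS --safe #-}
-- Record the construction of w(τ) as a growing list L of pairs (j , c), meaning w(j) = c̄.
-- The vacant positions are exactly those that are not positions of L, so the first m vacant
-- positions ≥ p are the m smallest integers ≥ p that are not positions of L, which is the
-- rule choosing the m smallest unused values ≥ q with positions and values exchanged.  Hence
-- the dual triple builds L with every pair swapped.  Each step fills as many cells as it uses
-- values, so in the final fill the vacant positions and the unused values in 1 … n are
-- equinumerous; they are matched in increasing order, and the dual fill matches them the
-- other way round.
module Submission where

open import Defs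
open import Data.Nat using (ℕ; zero; suc; _+_; _∸_; _⊓_; _≤_; _<_; _≤ᵇ_; _≡ᵇ_; z≤n; s≤s)
open import Data.Nat.Properties
open import Data.Bool using (Bool; true; false; if_then_else_; not; _∨_)
open import Data.Bool.Properties using (∨-zeroʳ; T-≡)
open import Data.Integer using (ℤ; +_; -[1+_]; -_)
open import Data.Integer.Properties using (neg-involutive)
open import Data.List using (List; []; _∷_; length; map; applyUpTo; replicate; _++_; zip)
open import Data.List.Properties using (map-∘; map-++; length-map; length-++; length-replicate; map-zipWith; zipWith-flip; length-zipWith)
open import Data.List.Membership.Propositional using (_∈_; _∉_)
open import Data.List.Membership.Propositional.Properties using (∈-map⁺; ∈-map⁻; ∈-++⁺ˡ; ∈-++⁺ʳ; ∈-++⁻)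
open import Data.List.Relation.Unary.All using (All; []; _∷_)
open import Data.List.Relation.Unary.Any using (here; there)
open import Data.Maybe using (Maybe; just; nothing; _<∣>_)
open import Data.Maybe.Properties using (<∣>-identityʳ)
open import Data.Product using (Σ; ∃; _×_; _,_; proj₁; proj₂; swap)
open import Data.Sum using (_⊎_; inj₁; inj₂)
open import Data.Unit using (⊤; tt)
open import Data.Empty using (⊥-elim)
open import Function using (Equivalence; case_of_)
open import Relation.Binary.PropositionalEquality using (_≡_; _≢_; refl; sym; trans; cong; cong₂; subst; module ≡-Reasoning)
open import Relation.Nullary using (yes; no)

≡ᵇ-refl : ∀ n → (n ≡ᵇ n) ≡ true
≡ᵇ-refl n = Equivalence.to T-≡ (≡⇒≡ᵇ n n refl)

≡ᵇ-true⇒≡ : ∀ {m n} → (m ≡ᵇ n) ≡ true → m ≡ n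
≡ᵇ-true⇒≡ {m} {n} eq = ≡ᵇ⇒≡ m n (Equivalence.from T-≡ eq)

≢⇒≡ᵇ-false : ∀ {m n} → m ≢ n → (m ≡ᵇ n) ≡ false
≢⇒≡ᵇ-false {m} {n} m≢n with m ≡ᵇ n in eq
... | true  = ⊥-elim (m≢n (≡ᵇ-true⇒≡ eq))
... | false = refl

≤⇒≤ᵇ-true : ∀ {m n} → m ≤ n → (m ≤ᵇ n) ≡ true
≤⇒≤ᵇ-true m≤n = Equivalence.to T-≡ (≤⇒≤ᵇ m≤n)

>⇒≤ᵇ-false : ∀ {m n} → n < m → (m ≤ᵇ n) ≡ false
>⇒≤ᵇ-false {m} {n} n<m with m ≤ᵇ n in eq
... | true  = ⊥-elim (<⇒≱ n<m (≤ᵇ⇒≤ m n (Equivalence.from T-≡ eq)))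
... | false = refl

reject : (ℕ → Bool) → List ℕ → List ℕ
reject g [] = []
reject g (x ∷ xs) = if g x then reject g xs else x ∷ reject g xs

range : ℕ → ℕ → List ℕ
range a zero = []
range a (suc r) = a ∷ range (suc a) r

Ascending : ℕ → List ℕ → Set
Ascending a [] = ⊤
Ascending a (x ∷ xs) = a ≤ x × Ascending (suc x) xs

reject-true : ∀ g x xs → g x ≡ true → reject g (x ∷ xs) ≡ reject g xs
reject-true g x xs gx rewrite gx = refl

reject-false : ∀ g x xs → g x ≡ false → reject g (x ∷ xs) ≡ x ∷ reject g xs
reject-false g x xs gx rewrite gx = refl

reject-const-false : ∀ xs → reject (λ _ → false) xs ≡ xs
reject-const-false [] = refl
reject-const-false (x ∷ xs) = cong (x ∷_) (reject-const-false xs)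

reject-++ : ∀ g xs ys → reject g (xs ++ ys) ≡ reject g xs ++ reject g ys
reject-++ g [] ys = refl
reject-++ g (x ∷ xs) ys with g x
... | true  = reject-++ g xs ys
... | false = cong (x ∷_) (reject-++ g xs ys)

∈-reject⁻ : ∀ {x} g xs → x ∈ reject g xs → x ∈ xs × g x ≡ false
∈-reject⁻ g (y ∷ xs) x∈ with g y in gy
∈-reject⁻ g (y ∷ xs) x∈         | true  = let (x∈xs , gx) = ∈-reject⁻ g xs x∈ in there x∈xs , gx
∈-reject⁻ g (y ∷ xs) (here refl) | false = here refl , gy
∈-reject⁻ g (y ∷ xs) (there x∈)  | false = let (x∈xs , gx) = ∈-reject⁻ g xs x∈ in there x∈xs , gx

∈-reject⁺ : ∀ {x} g xs → x ∈ xs → g x ≡ false → x ∈ reject g xs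
∈-reject⁺ g (y ∷ xs) (here refl) gx rewrite gx = here refl
∈-reject⁺ g (y ∷ xs) (there x∈) gx with g y
... | true  = ∈-reject⁺ g xs x∈ gx
... | false = there (∈-reject⁺ g xs x∈ gx)

length-range : ∀ a r → length (range a r) ≡ r
length-range a zero = refl
length-range a (suc r) = cong suc (length-range (suc a) r)

range-++ : ∀ a r s → range a (r + s) ≡ range a r ++ range (a + r) s
range-++ a zero s rewrite +-identityʳ a = refl
range-++ a (suc r) s rewrite +-suc a r = cong (a ∷_) (range-++ (suc a) r s)

range-split : ∀ a {r s} → r ≤ s → range a s ≡ range a r ++ range (a + r) (s ∸ r)
range-split a {r} {s} r≤s = trans (cong (range a) (sym (m+[n∸m]≡n r≤s))) (range-++ a r (s ∸ r))

applyUpTo≡range : ∀ r (f : ℕ → ℕ) a → (∀ j → f j ≡ a + j) → applyUpTo f r ≡ range a r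
applyUpTo≡range zero f a f≗ = refl
applyUpTo≡range (suc r) f a f≗ =
  cong₂ _∷_ (trans (f≗ 0) (+-identityʳ a))
            (applyUpTo≡range r (λ j → f (suc j)) (suc a) (λ j → trans (f≗ (suc j)) (+-suc a j)))

∈-range⁻ : ∀ {x} a r → x ∈ range a r → a ≤ x × x < a + r
∈-range⁻ a (suc r) (here refl) = ≤-refl , subst (a <_) (sym (+-suc a r)) (s≤s (m≤m+n a r))
∈-range⁻ {x} a (suc r) (there x∈) =
  let (a<x , x<) = ∈-range⁻ (suc a) r x∈ in <⇒≤ a<x , subst (x <_) (sym (+-suc a r)) x<

∈-range⁺ : ∀ {x} a r → a ≤ x → x < a + r → x ∈ range a r
∈-range⁺ {x} a zero a≤x x< = ⊥-elim (<⇒≱ x< (subst (_≤ x) (sym (+-identityʳ a)) a≤x))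
∈-range⁺ {x} a (suc r) a≤x x< with a ≟ x
... | yes refl = here refl
... | no  a≢x  = there (∈-range⁺ (suc a) r (≤∧≢⇒< a≤x a≢x) (subst (x <_) (+-suc a r) x<))

ascending-weaken : ∀ {a a'} xs → a' ≤ a → Ascending a xs → Ascending a' xs
ascending-weaken [] a'≤a asc = tt
ascending-weaken (x ∷ xs) a'≤a (a≤x , asc) = ≤-trans a'≤a a≤x , asc

ascending-range : ∀ a r → Ascending a (range a r)
ascending-range a zero = tt
ascending-range a (suc r) = ≤-refl , ascending-range (suc a) r

ascending-reject : ∀ {a} g xs → Ascending a xs → Ascending a (reject g xs)
ascending-reject g [] asc = tt
ascending-reject g (x ∷ xs) (a≤x , asc) with g x
... | true  = ascending-weaken (reject g xs) (≤-trans a≤x (n≤1+n x)) (ascending-reject g xs asc)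
... | false = a≤x , ascending-reject g xs asc

ascending-take : ∀ {a} m xs → Ascending a xs → Ascending a (take m xs)
ascending-take zero xs asc = tt
ascending-take (suc m) [] asc = tt
ascending-take (suc m) (x ∷ xs) (a≤x , asc) = a≤x , ascending-take m xs asc

ascending-∈ : ∀ {a x} xs → Ascending a xs → x ∈ xs → a ≤ x
ascending-∈ (y ∷ xs) (a≤y , asc) (here refl) = a≤y
ascending-∈ (y ∷ xs) (a≤y , asc) (there x∈) = ≤-trans (≤-trans a≤y (n≤1+n _)) (ascending-∈ xs asc x∈)

take-prefix : ∀ m (xs ys : List ℕ) → m ≤ length xs → take m (xs ++ ys) ≡ take m xs
take-prefix zero xs ys m≤ = refl
take-prefix (suc m) (x ∷ xs) ys (s≤s m≤) = cong (x ∷_) (take-prefix m xs ys m≤)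

take-all : ∀ m (xs : List ℕ) → length xs ≤ m → take m xs ≡ xs
take-all zero [] ≤m = refl
take-all (suc m) [] ≤m = refl
take-all (suc m) (x ∷ xs) (s≤s ≤m) = cong (x ∷_) (take-all m xs ≤m)

length-take : ∀ m (xs : List ℕ) → m ≤ length xs → length (take m xs) ≡ m
length-take zero xs m≤ = refl
length-take (suc m) (x ∷ xs) (s≤s m≤) = cong suc (length-take m xs m≤)

∈-take⁻ : ∀ {x} m (xs : List ℕ) → x ∈ take m xs → x ∈ xs
∈-take⁻ (suc m) (y ∷ xs) (here x≡y) = here x≡y
∈-take⁻ (suc m) (y ∷ xs) (there x∈) = there (∈-take⁻ m xs x∈)

mem-complete : ∀ {c} xs → c ∈ xs → mem c xs ≡ true
mem-complete {c} (x ∷ xs) (here refl) rewrite ≡ᵇ-refl c = refl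
mem-complete {c} (x ∷ xs) (there c∈) with c ≡ᵇ x
... | true  = refl
... | false = mem-complete xs c∈

mem-sound : ∀ {c} xs → mem c xs ≡ true → c ∈ xs
mem-sound {c} (x ∷ xs) eq with c ≡ᵇ x in c≡ᵇx
... | true  = here (≡ᵇ-true⇒≡ c≡ᵇx)
... | false = there (mem-sound xs eq)

mem-false⇒∉ : ∀ {c} xs → mem c xs ≡ false → c ∉ xs
mem-false⇒∉ xs eq c∈ = case trans (sym eq) (mem-complete xs c∈) of λ ()

∉⇒mem-false : ∀ {c} xs → c ∉ xs → mem c xs ≡ false
∉⇒mem-false {c} xs c∉ with mem c xs in eq
... | true  = ⊥-elim (c∉ (mem-sound xs eq))
... | false = refl

unusedOf≡reject : ∀ U xs → unusedOf U xs ≡ reject (λ c → mem c U) xs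
unusedOf≡reject U [] = refl
unusedOf≡reject U (x ∷ xs) rewrite unusedOf≡reject U xs = refl

reject-≡ᵇ-absent : ∀ u ys → Ascending (suc u) ys → reject (λ c → c ≡ᵇ u) ys ≡ ys
reject-≡ᵇ-absent u [] asc = refl
reject-≡ᵇ-absent u (y ∷ ys) (u<y , asc) rewrite ≢⇒≡ᵇ-false (λ y≡u → <-irrefl (sym y≡u) u<y) =
  cong (y ∷_) (reject-≡ᵇ-absent u ys (ascending-weaken ys (≤-trans u<y (n≤1+n y)) asc))

length-reject-≡ᵇ : ∀ {a} u ys → Ascending a ys → length ys ≤ suc (length (reject (λ c → c ≡ᵇ u) ys))
length-reject-≡ᵇ u [] asc = z≤n
length-reject-≡ᵇ u (y ∷ ys) (_ , asc) with y ≡ᵇ u in y≡ᵇu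
... | false = s≤s (length-reject-≡ᵇ u ys asc)
... | true with ≡ᵇ-true⇒≡ {y} {u} y≡ᵇu
...   | refl rewrite reject-≡ᵇ-absent y ys asc = ≤-refl

reject-mem-∷ : ∀ u U xs →
  reject (λ c → mem c (u ∷ U)) xs ≡ reject (λ c → c ≡ᵇ u) (reject (λ c → mem c U) xs)
reject-mem-∷ u U [] = refl
reject-mem-∷ u U (x ∷ xs) with x ≡ᵇ u in x≡ᵇu | mem x U
... | true  | true  = reject-mem-∷ u U xs
... | true  | false =
  trans (reject-mem-∷ u U xs) (sym (reject-true (λ c → c ≡ᵇ u) x (reject (λ c → mem c U) xs) x≡ᵇu))
... | false | true  = reject-mem-∷ u U xs
... | false | false =
  trans (cong (x ∷_) (reject-mem-∷ u U xs)) (sym (reject-false (λ c → c ≡ᵇ u) x (reject (λ c → mem c U) xs) x≡ᵇu))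

length-reject-mem : ∀ U xs {a} → Ascending a xs →
  length xs ≤ length (reject (λ c → mem c U) xs) + length U
length-reject-mem [] xs asc =
  ≤-reflexive (trans (cong length (sym (reject-const-false xs))) (sym (+-identityʳ _)))
length-reject-mem (u ∷ U) xs asc rewrite reject-mem-∷ u U xs = begin
  length xs                                              ≤⟨ length-reject-mem U xs asc ⟩
  length R + length U                                    ≤⟨ +-monoˡ-≤ (length U) (length-reject-≡ᵇ u R asc-R) ⟩
  suc (length (reject (λ c → c ≡ᵇ u) R)) + length U      ≡⟨ sym (+-suc _ (length U)) ⟩
  length (reject (λ c → c ≡ᵇ u) R) + suc (length U)      ∎
  where
  open ≤-Reasoning
  R : List ℕ
  R = reject (λ c → mem c U) xs
  asc-R : Ascending _ R
  asc-R = ascending-reject (λ c → mem c U) xs asc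

chooseVals≡ : ∀ m q U → chooseVals m q U ≡ take m (reject (λ c → mem c U) (range q (length U + m)))
chooseVals≡ m q U
  rewrite unusedOf≡reject U (applyUpTo (λ j → q + j) (length U + m))
        | applyUpTo≡range (length U + m) (λ j → q + j) q (λ j → refl) = refl

-- pigeonhole: an ascending list meets U in at most length U entries
length-candidates : ∀ m q U → m ≤ length (reject (λ c → mem c U) (range q (length U + m)))
length-candidates m q U = +-cancelʳ-≤ (length U) m _ (begin
  m + length U                   ≡⟨ +-comm m (length U) ⟩
  length U + m                   ≡⟨ sym (length-range q (length U + m)) ⟩
  length (range q (length U + m)) ≤⟨ length-reject-mem U _ (ascending-range q (length U + m)) ⟩
  length (reject (λ c → mem c U) (range q (length U + m))) + length U ∎)
  where open ≤-Reasoning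

length-chooseVals : ∀ m q U → length (chooseVals m q U) ≡ m
length-chooseVals m q U rewrite chooseVals≡ m q U = length-take m _ (length-candidates m q U)

ascending-chooseVals : ∀ m q U → Ascending q (chooseVals m q U)
ascending-chooseVals m q U rewrite chooseVals≡ m q U =
  ascending-take m _ (ascending-reject (λ c → mem c U) _ (ascending-range q (length U + m)))

∈-chooseVals⁻ : ∀ {c} m q U → c ∈ chooseVals m q U → (q ≤ c × c < q + (length U + m)) × c ∉ U
∈-chooseVals⁻ m q U c∈ rewrite chooseVals≡ m q U =
  let (c∈range , unused) = ∈-reject⁻ (λ c → mem c U) _ (∈-take⁻ m _ c∈)
  in ∈-range⁻ q _ c∈range , mem-false⇒∉ U unused

module _ {A B : Set} where

  ∈-zip⁻ˡ : ∀ {x : A} {y : B} xs ys → (x , y) ∈ zip xs ys → x ∈ xs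
  ∈-zip⁻ˡ (a ∷ xs) (b ∷ ys) (here refl) = here refl
  ∈-zip⁻ˡ (a ∷ xs) (b ∷ ys) (there xy∈) = there (∈-zip⁻ˡ xs ys xy∈)

  ∈-zip⁻ʳ : ∀ {x : A} {y : B} xs ys → (x , y) ∈ zip xs ys → y ∈ ys
  ∈-zip⁻ʳ (a ∷ xs) (b ∷ ys) (here refl) = here refl
  ∈-zip⁻ʳ (a ∷ xs) (b ∷ ys) (there xy∈) = there (∈-zip⁻ʳ xs ys xy∈)

  ∈-zip-swap : ∀ {x : A} {y : B} xs ys → (x , y) ∈ zip xs ys → (y , x) ∈ zip ys xs
  ∈-zip-swap (a ∷ xs) (b ∷ ys) (here refl) = here refl
  ∈-zip-swap (a ∷ xs) (b ∷ ys) (there xy∈) = there (∈-zip-swap xs ys xy∈)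

  ∈-zip-++ʳ : ∀ {x : A} {y : B} xs ys zs → (x , y) ∈ zip xs ys → (x , y) ∈ zip xs (ys ++ zs)
  ∈-zip-++ʳ (a ∷ xs) (b ∷ ys) zs (here refl) = here refl
  ∈-zip-++ʳ (a ∷ xs) (b ∷ ys) zs (there xy∈) = there (∈-zip-++ʳ xs ys zs xy∈)

  ∈-zip⁺ : ∀ {x : A} xs (ys : List B) → x ∈ xs → length xs ≤ length ys → ∃ λ y → (x , y) ∈ zip xs ys
  ∈-zip⁺ (a ∷ xs) (b ∷ ys) (here refl) _ = b , here refl
  ∈-zip⁺ (a ∷ xs) (b ∷ ys) (there x∈) (s≤s len≤) = let (y , xy∈) = ∈-zip⁺ xs ys x∈ len≤ in y , there xy∈

  map-proj₂-zip : ∀ (xs : List A) (ys : List B) → length ys ≤ length xs → map proj₂ (zip xs ys) ≡ ys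
  map-proj₂-zip [] [] _ = refl
  map-proj₂-zip (x ∷ xs) [] _ = refl
  map-proj₂-zip (x ∷ xs) (y ∷ ys) (s≤s len≤) = cong (y ∷_) (map-proj₂-zip xs ys len≤)

  length-zip : ∀ {m} (xs : List A) (ys : List B) → length xs ≡ m → length ys ≡ m → length (zip xs ys) ≡ m
  length-zip {m} xs ys refl ys≡ = trans (length-zipWith _,_ xs ys) (trans (cong (length xs ⊓_) ys≡) (⊓-idem m))

  map-swap-zip : ∀ (xs : List A) (ys : List B) → map swap (zip xs ys) ≡ zip ys xs
  map-swap-zip xs ys = trans (map-zipWith _,_ swap xs ys) (zipWith-flip (λ x y → (y , x)) xs ys)

<∣>≡just⁻ : ∀ {A : Set} (mx my : Maybe A) {z} → (mx <∣> my) ≡ just z →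
  mx ≡ just z ⊎ (mx ≡ nothing × my ≡ just z)
<∣>≡just⁻ (just x) my eq = inj₁ eq
<∣>≡just⁻ nothing my eq = inj₂ (refl , eq)

lookupKey : ℕ → List (ℕ × ℤ) → Maybe ℤ
lookupKey j [] = nothing
lookupKey j ((k , v) ∷ kvs) = if j ≡ᵇ k then just v else lookupKey j kvs

lookupKey-below : ∀ j J (vs : List ℤ) → Ascending (suc j) J → lookupKey j (zip J vs) ≡ nothing
lookupKey-below j [] vs asc = refl
lookupKey-below j (k ∷ J) [] asc = refl
lookupKey-below j (k ∷ J) (v ∷ vs) (j<k , asc) rewrite ≢⇒≡ᵇ-false (λ j≡k → <-irrefl j≡k j<k) =
  lookupKey-below j J vs (ascending-weaken J (≤-trans (n≤1+n (suc j)) (s≤s j<k)) asc)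

lookupKey-∈ : ∀ {a j c} J cs (f : ℕ → ℤ) → Ascending a J → (j , c) ∈ zip J cs →
  lookupKey j (zip J (map f cs)) ≡ just (f c)
lookupKey-∈ {j = j} (k ∷ J) (c ∷ cs) f asc (here refl) rewrite ≡ᵇ-refl j = refl
lookupKey-∈ {j = j} (k ∷ J) (c ∷ cs) f (_ , asc) (there jc∈)
  rewrite ≢⇒≡ᵇ-false (λ j≡k → <-irrefl (sym j≡k) (ascending-∈ J asc (∈-zip⁻ˡ J cs jc∈))) =
  lookupKey-∈ J cs f asc jc∈

lookupKey-just : ∀ {j x} J cs (f : ℕ → ℤ) → lookupKey j (zip J (map f cs)) ≡ just x →
  ∃ λ c → x ≡ f c × (j , c) ∈ zip J cs
lookupKey-just {j} (k ∷ J) (c ∷ cs) f eq with j ≡ᵇ k in j≡ᵇk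
... | true with ≡ᵇ-true⇒≡ {j} {k} j≡ᵇk | eq
...   | refl | refl = c , refl , here refl
lookupKey-just {j} (k ∷ J) (c ∷ cs) f eq | false =
  let (c' , x≡ , jc∈) = lookupKey-just J cs f eq in c' , x≡ , there jc∈

-- Boards

cell : ℕ → Board → Maybe ℤ
cell i [] = nothing
cell zero (x ∷ b) = x
cell (suc i) (x ∷ b) = cell i b

vacancies : Board → ℕ
vacancies [] = 0
vacancies (just _ ∷ b) = vacancies b
vacancies (nothing ∷ b) = suc (vacancies b)

targets : ℕ → ℕ → ℕ → Board → List ℕ
targets pos p zero b = []
targets pos p (suc m) [] = []
targets pos p (suc m) (just x ∷ b) = targets (suc pos) p (suc m) b
targets pos p (suc m) (nothing ∷ b) =
  if p ≤ᵇ pos then pos ∷ targets (suc pos) p m b else targets (suc pos) p (suc m) b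

ascending-targets : ∀ pos p m b → Ascending pos (targets pos p m b)
ascending-targets pos p zero b = tt
ascending-targets pos p (suc m) [] = tt
ascending-targets pos p (suc m) (just x ∷ b) =
  ascending-weaken (targets (suc pos) p (suc m) b) (n≤1+n pos) (ascending-targets (suc pos) p (suc m) b)
ascending-targets pos p (suc m) (nothing ∷ b) with p ≤ᵇ pos
... | true  = ≤-refl , ascending-targets (suc pos) p m b
... | false = ascending-weaken (targets (suc pos) p (suc m) b) (n≤1+n pos) (ascending-targets (suc pos) p (suc m) b)

cell-fillFrom : ∀ pos p vs b i →
  cell i (fillFrom pos p vs b) ≡ cell i b <∣> lookupKey (pos + i) (zip (targets pos p (length vs) b) vs)
cell-fillFrom pos p [] b i = sym (<∣>-identityʳ (cell i b))
cell-fillFrom pos p (v ∷ vs) [] i = refl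
cell-fillFrom pos p (v ∷ vs) (just x ∷ b) zero = refl
cell-fillFrom pos p (v ∷ vs) (just x ∷ b) (suc i) rewrite +-suc pos i = cell-fillFrom (suc pos) p (v ∷ vs) b i
cell-fillFrom pos p (v ∷ vs) (nothing ∷ b) i with p ≤ᵇ pos
cell-fillFrom pos p (v ∷ vs) (nothing ∷ b) zero | true rewrite +-identityʳ pos | ≡ᵇ-refl pos = refl
cell-fillFrom pos p (v ∷ vs) (nothing ∷ b) (suc i) | true
  rewrite ≢⇒≡ᵇ-false (m+1+n≢m pos {i}) | +-suc pos i = cell-fillFrom (suc pos) p vs b i
cell-fillFrom pos p (v ∷ vs) (nothing ∷ b) zero | false rewrite +-identityʳ pos =
  sym (lookupKey-below pos (targets (suc pos) p (suc (length vs)) b) (v ∷ vs)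
        (ascending-targets (suc pos) p (suc (length vs)) b))
cell-fillFrom pos p (v ∷ vs) (nothing ∷ b) (suc i) | false rewrite +-suc pos i =
  cell-fillFrom (suc pos) p (v ∷ vs) b i

vacancies-fillFrom : ∀ pos p vs b →
  vacancies (fillFrom pos p vs b) + length (targets pos p (length vs) b) ≡ vacancies b
vacancies-fillFrom pos p [] b = +-identityʳ _
vacancies-fillFrom pos p (v ∷ vs) [] = refl
vacancies-fillFrom pos p (v ∷ vs) (just x ∷ b) = vacancies-fillFrom (suc pos) p (v ∷ vs) b
vacancies-fillFrom pos p (v ∷ vs) (nothing ∷ b) with p ≤ᵇ pos
... | true  = trans (+-suc _ _) (cong suc (vacancies-fillFrom (suc pos) p vs b))
... | false = cong suc (vacancies-fillFrom (suc pos) p (v ∷ vs) b)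

length-fillFrom : ∀ pos p vs b → length (fillFrom pos p vs b) ≡ length b
length-fillFrom pos p [] b = refl
length-fillFrom pos p (v ∷ vs) [] = refl
length-fillFrom pos p (v ∷ vs) (just x ∷ b) = cong suc (length-fillFrom (suc pos) p (v ∷ vs) b)
length-fillFrom pos p (v ∷ vs) (nothing ∷ b) with p ≤ᵇ pos
... | true  = cong suc (length-fillFrom (suc pos) p vs b)
... | false = cong suc (length-fillFrom (suc pos) p (v ∷ vs) b)

Occupancy : ℕ → (ℕ → Bool) → Board → Set
Occupancy a g b = ∀ i → i < length b →
  (cell i b ≡ nothing → g (a + i) ≡ false) × (g (a + i) ≡ false → cell i b ≡ nothing)

occupancy-tail : ∀ {a g x b} → Occupancy a g (x ∷ b) → Occupancy (suc a) g b
occupancy-tail {a} occ i i< rewrite sym (+-suc a i) = occ (suc i) (s≤s i<)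

occupancy-just : ∀ {a g x b} → Occupancy a g (just x ∷ b) → g a ≡ true
occupancy-just {a} {g} occ with g a in ga
... | true  = refl
... | false = case proj₂ (occ 0 (s≤s z≤n)) (trans (cong g (+-identityʳ a)) ga) of λ ()

occupancy-nothing : ∀ {a g b} → Occupancy a g (nothing ∷ b) → g a ≡ false
occupancy-nothing {a} {g} occ = trans (cong g (sym (+-identityʳ a))) (proj₁ (occ 0 (s≤s z≤n)) refl)

unavailable : ℕ → (ℕ → Bool) → ℕ → Bool
unavailable p g j = not (p ≤ᵇ j) ∨ g j

targets≡take-reject : ∀ a p m b g → Occupancy a g b →
  targets a p m b ≡ take m (reject (unavailable p g) (range a (length b)))
targets≡take-reject a p zero b g occ = refl
targets≡take-reject a p (suc m) [] g occ = refl
targets≡take-reject a p (suc m) (just x ∷ b) g occ =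
  trans (targets≡take-reject (suc a) p (suc m) b g (occupancy-tail {a} {g} {_} {b} occ))
    (cong (take (suc m)) (sym (reject-true (unavailable p g) a (range (suc a) (length b))
      (trans (cong (not (p ≤ᵇ a) ∨_) (occupancy-just {a} {g} {x} {b} occ)) (∨-zeroʳ _)))))
targets≡take-reject a p (suc m) (nothing ∷ b) g occ with p ≤ᵇ a
... | true rewrite occupancy-nothing {a} {g} {b} occ =
  cong (a ∷_) (targets≡take-reject (suc a) p m b g (occupancy-tail {a} {g} {_} {b} occ))
... | false = targets≡take-reject (suc a) p (suc m) b g (occupancy-tail {a} {g} {_} {b} occ)

vacancies≡length-reject : ∀ a b g → Occupancy a g b → vacancies b ≡ length (reject g (range a (length b)))
vacancies≡length-reject a [] g occ = refl
vacancies≡length-reject a (just x ∷ b) g occ =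
  trans (vacancies≡length-reject (suc a) b g (occupancy-tail {a} {g} {_} {b} occ))
    (cong length (sym (reject-true g a (range (suc a) (length b)) (occupancy-just {a} {g} {x} {b} occ))))
vacancies≡length-reject a (nothing ∷ b) g occ =
  trans (cong suc (vacancies≡length-reject (suc a) b g (occupancy-tail {a} {g} {_} {b} occ)))
    (cong length (sym (reject-false g a (range (suc a) (length b)) (occupancy-nothing {a} {g} {b} occ))))

reject-unavailable-below : ∀ p g a r → a + r ≤ p → reject (unavailable p g) (range a r) ≡ []
reject-unavailable-below p g a zero _ = refl
reject-unavailable-below p g a (suc r) a+r≤p =
  trans (reject-true (unavailable p g) a (range (suc a) r) a-unavailable)
    (reject-unavailable-below p g (suc a) r (subst (_≤ p) (+-suc a r) a+r≤p))
  where
  a-unavailable : unavailable p g a ≡ true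
  a-unavailable rewrite >⇒≤ᵇ-false {p} {a} (≤-trans (s≤s (m≤m+n a r)) (subst (_≤ p) (+-suc a r) a+r≤p)) = refl

reject-unavailable-above : ∀ p g a r → p ≤ a → reject (unavailable p g) (range a r) ≡ reject g (range a r)
reject-unavailable-above p g a zero _ = refl
reject-unavailable-above p g a (suc r) p≤a rewrite ≤⇒≤ᵇ-true p≤a with g a
... | true  = reject-unavailable-above p g (suc a) r (≤-trans p≤a (n≤1+n a))
... | false = cong (a ∷_) (reject-unavailable-above p g (suc a) r (≤-trans p≤a (n≤1+n a)))

-- The construction as a growing matching

Matching : Set
Matching = List (ℕ × ℕ)

positions values : Matching → List ℕ
positions = map proj₁
values = map proj₂

extend : ℕ → ℕ → ℕ → Matching → Matching
extend m p q L = L ++ zip (chooseVals m p (positions L)) (chooseVals m q (values L))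

length-extend : ∀ m p q L → length (extend m p q L) ≡ length L + m
length-extend m p q L = trans (length-++ L) (cong (λ t → length L + t)
  (length-zip (chooseVals m p (positions L)) (chooseVals m q (values L))
              (length-chooseVals m p (positions L)) (length-chooseVals m q (values L))))

neg : ℕ → ℤ
neg c = - (+ c)

record Represents (n : ℕ) (L : Matching) (b : Board) : Set where
  field
    length≡ : length b ≡ n
    occupied⇒∈ : ∀ {i x} → cell i b ≡ just x → ∃ λ c → x ≡ neg c × (suc i , c) ∈ L
    ∈⇒occupied : ∀ {j c} → (j , c) ∈ L → ∃ λ i → j ≡ suc i × i < n × cell i b ≡ just (neg c)
    vacancies+length≡ : vacancies b + length L ≡ n

open Represents

represents-occupancy : ∀ {n L b} → Represents n L b → Occupancy 1 (λ j → mem j (positions L)) b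
represents-occupancy {n} {L} {b} R i _ = vacant⇒free , free⇒vacant
  where
  vacant⇒free : cell i b ≡ nothing → mem (suc i) (positions L) ≡ false
  vacant⇒free vacant = ∉⇒mem-false (positions L) λ si∈ →
    let ((j , c) , jc∈ , si≡j) = ∈-map⁻ proj₁ si∈
        (i' , j≡ , _ , occupied) = ∈⇒occupied R jc∈
        i≡i' = suc-injective (trans si≡j j≡)
    in case trans (sym vacant) (subst (λ k → cell k b ≡ just (neg c)) (sym i≡i') occupied) of λ ()
  free⇒vacant : mem (suc i) (positions L) ≡ false → cell i b ≡ nothing
  free⇒vacant free with cell i b in ci
  ... | nothing = refl
  ... | just x = let (c , _ , ic∈) = occupied⇒∈ R ci in
                 ⊥-elim (mem-false⇒∉ (positions L) free (∈-map⁺ proj₁ ic∈))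

targets≡chooseVals : ∀ {n L b} m p' → suc p' + (length L + m) ≤ suc n → Represents n L b →
  targets 1 (suc p') m b ≡ chooseVals m (suc p') (positions L)
targets≡chooseVals {n} {L} {b} m p' room R = begin
  targets 1 p m b
    ≡⟨ targets≡take-reject 1 p m b g (represents-occupancy R) ⟩
  take m (reject h (range 1 (length b)))
    ≡⟨ cong (λ t → take m (reject h (range 1 t))) (length≡ R) ⟩
  take m (reject h (range 1 n))
    ≡⟨ cong (λ t → take m (reject h t)) (range-split 1 p'≤n) ⟩
  take m (reject h (range 1 p' ++ range p (n ∸ p')))
    ≡⟨ cong (take m) (reject-++ h (range 1 p') (range p (n ∸ p'))) ⟩
  take m (reject h (range 1 p') ++ reject h (range p (n ∸ p')))
    ≡⟨ cong₂ (λ s t → take m (s ++ t)) (reject-unavailable-below p g 1 p' ≤-refl)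
                                        (reject-unavailable-above p g p (n ∸ p') ≤-refl) ⟩
  take m (reject g (range p (n ∸ p')))
    ≡⟨ cong (λ t → take m (reject g t)) (range-split p window≤) ⟩
  take m (reject g (range p (length D + m) ++ beyond))
    ≡⟨ cong (take m) (reject-++ g (range p (length D + m)) beyond) ⟩
  take m (reject g (range p (length D + m)) ++ reject g beyond)
    ≡⟨ take-prefix m _ _ (length-candidates m p D) ⟩
  take m (reject g (range p (length D + m)))
    ≡⟨ sym (chooseVals≡ m p D) ⟩
  chooseVals m p D ∎
  where
  open ≡-Reasoning
  p : ℕ
  p = suc p'
  D : List ℕ
  D = positions L
  g h : ℕ → Bool
  g j = mem j D
  h = unavailable p g
  beyond : List ℕ
  beyond = range (p + (length D + m)) (n ∸ p' ∸ (length D + m))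
  room' : p' + (length L + m) ≤ n
  room' = ≤-pred room
  p'≤n : p' ≤ n
  p'≤n = ≤-trans (m≤m+n p' _) room'
  window≤ : length D + m ≤ n ∸ p'
  window≤ rewrite length-map proj₁ L =
    ≤-trans (≤-reflexive (sym (m+n∸m≡n p' (length L + m)))) (∸-monoˡ-≤ p' room')

module Step {n L b} (m p' q : ℕ) (room : suc p' + (length L + m) ≤ suc n) (R : Represents n L b) where

  p : ℕ
  p = suc p'

  J cs : List ℕ
  J = chooseVals m p (positions L)
  cs = chooseVals m q (values L)

  b' : Board
  b' = fillFrom 1 p (map neg cs) b

  placed : ℕ → Maybe ℤ
  placed j = lookupKey j (zip J (map neg cs))

  targets≡J : targets 1 p (length (map neg cs)) b ≡ J
  targets≡J = trans (cong (λ t → targets 1 p t b) (trans (length-map neg cs) (length-chooseVals m q (values L))))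
                    (targets≡chooseVals m p' room R)

  cell-b' : ∀ i → cell i b' ≡ cell i b <∣> placed (suc i)
  cell-b' i = trans (cell-fillFrom 1 p (map neg cs) b i)
                    (cong (λ t → cell i b <∣> lookupKey (suc i) (zip t (map neg cs))) targets≡J)

  occupied⇒∈-extend : ∀ {i x} → cell i b' ≡ just x → ∃ λ c → x ≡ neg c × (suc i , c) ∈ extend m p q L
  occupied⇒∈-extend {i} occupied with <∣>≡just⁻ (cell i b) _ (trans (sym (cell-b' i)) occupied)
  ... | inj₁ old      = let (c , x≡ , ic∈) = occupied⇒∈ R old in c , x≡ , ∈-++⁺ˡ ic∈
  ... | inj₂ (_ , new) = let (c , x≡ , ic∈) = lookupKey-just J cs neg new in c , x≡ , ∈-++⁺ʳ L ic∈

  new-occupied : ∀ {j c} → (j , c) ∈ zip J cs → ∃ λ i → j ≡ suc i × i < n × cell i b' ≡ just (neg c)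
  new-occupied {j} jc∈ with ∈-chooseVals⁻ m p (positions L) (∈-zip⁻ˡ J cs jc∈)
  new-occupied {suc i} {c} jc∈ | (_ , j<) , j∉ = i , refl , i<n , (begin
    cell i b'                     ≡⟨ cell-b' i ⟩
    cell i b <∣> placed (suc i)   ≡⟨ cong (_<∣> placed (suc i)) vacant ⟩
    placed (suc i)                ≡⟨ lookupKey-∈ J cs neg (ascending-chooseVals m p (positions L)) jc∈ ⟩
    just (neg c)                  ∎)
    where
    open ≡-Reasoning
    i<n : i < n
    i<n = ≤-pred (≤-trans j< (subst (λ l → suc p' + (l + m) ≤ suc n) (sym (length-map proj₁ L)) room))
    vacant : cell i b ≡ nothing
    vacant = proj₂ (represents-occupancy R i (subst (i <_) (sym (length≡ R)) i<n)) (∉⇒mem-false (positions L) j∉)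

  ∈-extend⇒occupied : ∀ {j c} → (j , c) ∈ extend m p q L →
    ∃ λ i → j ≡ suc i × i < n × cell i b' ≡ just (neg c)
  ∈-extend⇒occupied jc∈ with ∈-++⁻ L jc∈
  ... | inj₂ new = new-occupied new
  ... | inj₁ old = let (i , j≡ , i<n , occupied) = ∈⇒occupied R old in
                   i , j≡ , i<n , trans (cell-b' i) (cong (_<∣> placed (suc i)) occupied)

  vacancies+length-extend : vacancies b' + length (extend m p q L) ≡ n
  vacancies+length-extend = begin
    vacancies b' + length (extend m p q L)
      ≡⟨ cong (λ t → vacancies b' + t) (trans (length-extend m p q L) (+-comm (length L) m)) ⟩
    vacancies b' + (m + length L)
      ≡⟨ sym (+-assoc (vacancies b') m (length L)) ⟩
    vacancies b' + m + length L
      ≡⟨ cong (λ t → vacancies b' + t + length L) (sym length-targets) ⟩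
    vacancies b' + length T + length L
      ≡⟨ cong (_+ length L) (vacancies-fillFrom 1 p (map neg cs) b) ⟩
    vacancies b + length L
      ≡⟨ vacancies+length≡ R ⟩
    n ∎
    where
    open ≡-Reasoning
    T : List ℕ
    T = targets 1 p (length (map neg cs)) b
    length-targets : length T ≡ m
    length-targets = trans (cong length targets≡J) (length-chooseVals m p (positions L))

  represents : Represents n (extend m p q L) b'
  represents = record
    { length≡ = trans (length-fillFrom 1 p (map neg cs) b) (length≡ R)
    ; occupied⇒∈ = occupied⇒∈-extend
    ; ∈⇒occupied = ∈-extend⇒occupied
    ; vacancies+length≡ = vacancies+length-extend
    }

values-extend : ∀ m p q L → values L ++ chooseVals m q (values L) ≡ values (extend m p q L)
values-extend m p q L = sym (trans (map-++ proj₂ L (zip J cs)) (cong (values L ++_) (map-proj₂-zip J cs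
  (≤-reflexive (trans (length-chooseVals m q (values L)) (sym (length-chooseVals m p (positions L))))))))
  where
  J cs : List ℕ
  J = chooseVals m p (positions L)
  cs = chooseVals m q (values L)

matching : ℕ → List Column → Matching → Matching
matching prev [] L = L
matching prev ((k , p , q) ∷ τ) L = matching k τ (extend (k ∸ prev) p q L)

budget : ℕ → List Column → ℕ
budget prev [] = 0
budget prev ((k , p , q) ∷ τ) = (p + q + (k ∸ prev)) + budget k τ

PositiveBounds : Column → Set
PositiveBounds (_ , p , q) = 0 < p × 0 < q

room-step : ∀ l p q m r n → l + ((p + q + m) + r) ≤ n → p + (l + m) ≤ n
room-step l p q m r n within = begin
  p + (l + m)             ≡⟨ +-comm p (l + m) ⟩
  l + m + p               ≡⟨ +-assoc l m p ⟩
  l + (m + p)             ≡⟨ cong (λ t → l + t) (+-comm m p) ⟩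
  l + (p + m)             ≤⟨ +-monoʳ-≤ l (≤-trans (+-monoˡ-≤ m (m≤m+n p q)) (m≤m+n (p + q + m) r)) ⟩
  l + ((p + q + m) + r)   ≤⟨ within ⟩
  n                       ∎
  where open ≤-Reasoning

room-rest : ∀ l p q m r n → l + ((p + q + m) + r) ≤ n → l + m + r ≤ n
room-rest l p q m r n within = begin
  l + m + r               ≡⟨ +-assoc l m r ⟩
  l + (m + r)             ≤⟨ +-monoʳ-≤ l (+-monoˡ-≤ r (m≤n+m m (p + q))) ⟩
  l + ((p + q + m) + r)   ≤⟨ within ⟩
  n                       ∎
  where open ≤-Reasoning

Realises : ℕ → Matching → Board × List ℕ → Set
Realises n L (b , U) = Represents n L b × U ≡ values L

steps-realise : ∀ {n} τ prev L st → All PositiveBounds τ → length L + budget prev τ ≤ n →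
  Realises n L st → Realises n (matching prev τ L) (steps prev τ st)
steps-realise [] prev L st [] within realised = realised
steps-realise {n} ((k , suc p' , q) ∷ τ) prev L (b , _) ((s≤s z≤n , _) ∷ pos) within (R , refl)
  rewrite values-extend (k ∸ prev) (suc p') q L =
  steps-realise τ k (extend m (suc p') q L) _ pos within' (Step.represents m p' q room R , refl)
  where
  m : ℕ
  m = k ∸ prev
  room : suc p' + (length L + m) ≤ suc n
  room = ≤-trans (room-step (length L) (suc p') q m (budget k τ) n within) (n≤1+n n)
  within' : length (extend m (suc p') q L) + budget k τ ≤ n
  within' rewrite length-extend m (suc p') q L = room-rest (length L) (suc p') q m (budget k τ) n within

-- Duality

positions-swap : ∀ L → positions (map swap L) ≡ values L
positions-swap L = sym (map-∘ L)

values-swap : ∀ L → values (map swap L) ≡ positions L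
values-swap L = sym (map-∘ L)

extend-swap : ∀ m p q L → map swap (extend m p q L) ≡ extend m q p (map swap L)
extend-swap m p q L rewrite positions-swap L | values-swap L =
  trans (map-++ swap L (zip J cs)) (cong (map swap L ++_) (map-swap-zip J cs))
  where
  J cs : List ℕ
  J = chooseVals m p (positions L)
  cs = chooseVals m q (values L)

matching-dual : ∀ prev τ L → matching prev (dual τ) (map swap L) ≡ map swap (matching prev τ L)
matching-dual prev [] L = refl
matching-dual prev ((k , p , q) ∷ τ) L =
  trans (cong (matching k (dual τ)) (sym (extend-swap (k ∸ prev) p q L))) (matching-dual k τ _)

budget-dual : ∀ prev τ → budget prev (dual τ) ≡ budget prev τ
budget-dual prev [] = refl
budget-dual prev ((k , p , q) ∷ τ) = cong₂ _+_ (cong (_+ (k ∸ prev)) (+-comm q p)) (budget-dual k τ)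

positive-dual : ∀ {τ} → All PositiveBounds τ → All PositiveBounds (dual τ)
positive-dual [] = []
positive-dual ((0<p , 0<q) ∷ pos) = (0<q , 0<p) ∷ positive-dual pos

dual-involutive : ∀ τ → dual (dual τ) ≡ τ
dual-involutive [] = refl
dual-involutive (c ∷ τ) = cong (c ∷_) (dual-involutive τ)

triple⇒positive : ∀ τ → IsTriple τ → All PositiveBounds τ
triple⇒positive [] _ = []
triple⇒positive (_ ∷ []) (_ , 0<p , 0<q) = (0<p , 0<q) ∷ []
triple⇒positive (_ ∷ c ∷ τ) (_ , 0<p , 0<q , _ , _ , _ , _ , triple) =
  (0<p , 0<q) ∷ triple⇒positive (c ∷ τ) triple

cell-replicate : ∀ n i → cell i (replicate n nothing) ≡ nothing
cell-replicate zero i = refl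
cell-replicate (suc n) zero = refl
cell-replicate (suc n) (suc i) = cell-replicate n i

vacancies-replicate : ∀ n → vacancies (replicate n nothing) ≡ n
vacancies-replicate zero = refl
vacancies-replicate (suc n) = cong suc (vacancies-replicate n)

represents-empty : ∀ n → Represents n [] (replicate n nothing)
represents-empty n = record
  { length≡ = length-replicate n
  ; occupied⇒∈ = λ {i} occupied → case trans (sym (cell-replicate n i)) occupied of λ ()
  ; ∈⇒occupied = λ ()
  ; vacancies+length≡ = trans (+-identityʳ _) (vacancies-replicate n)
  }

run : ℕ → List Column → Board × List ℕ
run n τ = steps 0 τ (replicate n nothing , [])

run-realises : ∀ {n} τ → All PositiveBounds τ → budget 0 τ ≤ n → Realises n (matching 0 τ []) (run n τ)
run-realises {n} τ pos within = steps-realise τ 0 [] _ pos within (represents-empty n , refl)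

-- The final fill

free : List ℕ → ℕ → List ℕ
free U n = reject (λ c → mem c U) (range 1 n)

finalFill : ℕ → Board × List ℕ → Board
finalFill n (b , U) = fillFrom 1 0 (map +_ (unusedOf U (applyUpTo suc (n + length U)))) b

signed : Board → ℤ → ℤ
signed B (+ zero) = + zero
signed B (+ suc i) = at i B (+ suc i)
signed B -[1+ i ] = - (at i B (+ suc i))

wₙ≡signed : ∀ n τ z → wₙ n τ z ≡ signed (finalFill n (run n τ)) z
wₙ≡signed n τ (+ zero) = refl
wₙ≡signed n τ (+ suc i) = refl
wₙ≡signed n τ -[1+ i ] = refl

signed-neg : ∀ B z → signed B (- z) ≡ - signed B z
signed-neg B (+ zero) = refl
signed-neg B (+ suc i) = refl
signed-neg B -[1+ i ] = sym (neg-involutive _)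

at-occupied : ∀ {x} i B d → cell i B ≡ just x → at i B d ≡ x
at-occupied zero (just y ∷ B) d refl = refl
at-occupied (suc i) (_ ∷ B) d occupied = at-occupied i B d occupied

at-vacant : ∀ i B d → cell i B ≡ nothing → at i B d ≡ d
at-vacant i [] d _ = refl
at-vacant zero (nothing ∷ B) d _ = refl
at-vacant (suc i) (_ ∷ B) d vacant = at-vacant i B d vacant

cell-beyond : ∀ i (b : Board) → length b ≤ i → cell i b ≡ nothing
cell-beyond i [] _ = refl
cell-beyond (suc i) (x ∷ b) (s≤s ≤i) = cell-beyond i b ≤i

unusedOf-split : ∀ n U →
  unusedOf U (applyUpTo suc (n + length U)) ≡ free U n ++ reject (λ c → mem c U) (range (suc n) (length U))
unusedOf-split n U
  rewrite unusedOf≡reject U (applyUpTo suc (n + length U))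
        | applyUpTo≡range (n + length U) suc 1 (λ j → refl)
        | range-++ 1 n (length U) = reject-++ (λ c → mem c U) (range 1 n) (range (suc n) (length U))

length-finalFill : ∀ n st → length (finalFill n st) ≡ length (proj₁ st)
length-finalFill n (b , U) = length-fillFrom 1 0 (map +_ (unusedOf U (applyUpTo suc (n + length U)))) b

finalFill-occupied : ∀ {i x} n b U → cell i b ≡ just x → cell i (finalFill n (b , U)) ≡ just x
finalFill-occupied {i} n b U occupied =
  trans (cell-fillFrom 1 0 vs b i) (cong (_<∣> lookupKey (suc i) (zip (targets 1 0 (length vs) b) vs)) occupied)
  where
  vs : List ℤ
  vs = map +_ (unusedOf U (applyUpTo suc (n + length U)))

finalFill-free : ∀ {i r} n b D U → length b ≡ n → Occupancy 1 (λ j → mem j D) b →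
  length (free D n) ≤ length (free U n) → (suc i , r) ∈ zip (free D n) (free U n) →
  cell i (finalFill n (b , U)) ≡ just (+ r)
finalFill-free {i} {r} n b D U refl occ fits ir∈ = begin
  cell i (finalFill n (b , U))                           ≡⟨ cell-fillFrom 1 0 vs b i ⟩
  cell i b <∣> lookupKey (suc i) (zip T vs)              ≡⟨ cong (_<∣> lookupKey (suc i) (zip T vs)) vacant ⟩
  lookupKey (suc i) (zip T vs)
    ≡⟨ cong₂ (λ t us → lookupKey (suc i) (zip t us)) T≡ (cong (map (+_)) (unusedOf-split n U)) ⟩
  lookupKey (suc i) (zip (free D n) (map +_ values-out))
    ≡⟨ lookupKey-∈ (free D n) values-out +_ asc (∈-zip-++ʳ _ _ _ ir∈) ⟩
  just (+ r)                                             ∎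
  where
  open ≡-Reasoning
  values-out : List ℕ
  values-out = free U n ++ reject (λ c → mem c U) (range (suc n) (length U))
  unused : List ℕ
  unused = unusedOf U (applyUpTo suc (n + length U))
  vs : List ℤ
  vs = map +_ unused
  T : List ℕ
  T = targets 1 0 (length vs) b
  asc : Ascending 1 (free D n)
  asc = ascending-reject (λ c → mem c D) (range 1 n) (ascending-range 1 n)
  vacant : cell i b ≡ nothing
  vacant =
    let (si∈ , free-si) = ∈-reject⁻ (λ c → mem c D) (range 1 n) (∈-zip⁻ˡ _ _ ir∈)
    in proj₂ (occ i (≤-pred (proj₂ (∈-range⁻ 1 n si∈)))) free-si
  length-vs : length (free U n) ≤ length vs
  length-vs = ≤-trans (≤-trans (m≤m+n _ _) (≤-reflexive (sym (length-++ (free U n)))))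
    (≤-reflexive (sym (trans (length-map +_ unused) (cong length (unusedOf-split n U)))))
  T≡ : T ≡ free D n
  T≡ = trans (targets≡take-reject 1 0 (length vs) b (λ j → mem j D) occ)
             (take-all (length vs) (free D n) (≤-trans fits length-vs))

length-free : ∀ {n L b} → Represents n L b → length (free (positions L) n) + length L ≡ n
length-free {n} {L} {b} R = trans (cong (_+ length L) (sym vacancies≡)) (vacancies+length≡ R)
  where
  vacancies≡ : vacancies b ≡ length (free (positions L) n)
  vacancies≡ = trans (vacancies≡length-reject 1 b (λ j → mem j (positions L)) (represents-occupancy R))
                     (cong (λ t → length (free (positions L) t)) (length≡ R))

module Inverse {n L b b*} (R : Represents n L b) (R* : Represents n (map swap L) b*) where

  B B* : Board
  B = finalFill n (b , values L)
  B* = finalFill n (b* , positions L)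

  occupancy* : Occupancy 1 (λ j → mem j (values L)) b*
  occupancy* = subst (λ X → Occupancy 1 (λ j → mem j X) b*) (positions-swap L) (represents-occupancy R*)

  balanced : length (free (positions L) n) ≡ length (free (values L) n)
  balanced = +-cancelʳ-≡ (length L) _ _ (trans (length-free R) (sym (trans swapped (length-free R*))))
    where
    swapped : length (free (values L) n) + length L ≡ length (free (positions (map swap L)) n) + length (map swap L)
    swapped = cong₂ (λ X l → length (free X n) + l) (sym (positions-swap L)) (sym (length-map swap L))

  inverse-occupied : ∀ {i x} → cell i b ≡ just x → signed B* (signed B (+ suc i)) ≡ + suc i
  inverse-occupied {i} {x} occupied with occupied⇒∈ R occupied
  ... | c , x≡ , ic∈ with ∈⇒occupied R* (∈-map⁺ swap ic∈)
  ...   | i' , refl , _ , occupied* = begin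
    signed B* (signed B (+ suc i))   ≡⟨ cong (signed B*) (at-occupied i B _ (finalFill-occupied n b _ occupied)) ⟩
    signed B* x                      ≡⟨ cong (signed B*) x≡ ⟩
    signed B* -[1+ i' ]              ≡⟨ cong -_ (at-occupied i' B* _ (finalFill-occupied n b* _ occupied*)) ⟩
    + suc i                          ∎
    where open ≡-Reasoning

  vacant∈free : ∀ {i} → i < n → cell i b ≡ nothing → suc i ∈ free (positions L) n
  vacant∈free {i} i<n vacant =
    ∈-reject⁺ (λ c → mem c (positions L)) (range 1 n) (∈-range⁺ 1 n (s≤s z≤n) (s≤s i<n))
      (proj₁ (represents-occupancy R i (subst (i <_) (sym (length≡ R)) i<n)) vacant)

  inverse-vacant : ∀ {i} → i < n → cell i b ≡ nothing → signed B* (signed B (+ suc i)) ≡ + suc i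
  inverse-vacant {i} i<n vacant
    with ∈-zip⁺ (free (positions L) n) (free (values L) n) (vacant∈free i<n vacant) (≤-reflexive balanced)
  ... | r , ir∈
    with ∈-range⁻ 1 n (proj₁ (∈-reject⁻ (λ c → mem c (values L)) (range 1 n) (∈-zip⁻ʳ _ _ ir∈)))
  ...   | s≤s {n = i'} _ , _ = begin
    signed B* (signed B (+ suc i))   ≡⟨ cong (signed B*) (at-occupied i B _ (finalFill-free n b (positions L) (values L)
                                          (length≡ R) (represents-occupancy R) (≤-reflexive balanced) ir∈)) ⟩
    signed B* (+ suc i')             ≡⟨ at-occupied i' B* _ (finalFill-free n b* (values L) (positions L)
                                          (length≡ R*) occupancy* (≤-reflexive (sym balanced)) (∈-zip-swap _ _ ir∈)) ⟩
    + suc i                          ∎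
    where open ≡-Reasoning

  inverse-positive : ∀ i → signed B* (signed B (+ suc i)) ≡ + suc i
  inverse-positive i with i <? n
  ... | yes i<n with cell i b in ci
  ...   | just x  = inverse-occupied ci
  ...   | nothing = inverse-vacant i<n ci
  inverse-positive i | no i≮n = trans (cong (signed B*) (at-vacant i B _ (beyond R))) (at-vacant i B* _ (beyond R*))
    where
    beyond : ∀ {L' b' U} → Represents n L' b' → cell i (finalFill n (b' , U)) ≡ nothing
    beyond {b' = b'} {U} R' =
      cell-beyond i (finalFill n (b' , U))
        (subst (_≤ i) (sym (trans (length-finalFill n (b' , U)) (length≡ R'))) (≮⇒≥ i≮n))

  inverse : ∀ z → signed B* (signed B z) ≡ z
  inverse (+ zero) = refl
  inverse (+ suc i) = inverse-positive i
  inverse -[1+ i ] = begin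
    signed B* (signed B (- + suc i))   ≡⟨ cong (signed B*) (signed-neg B (+ suc i)) ⟩
    signed B* (- signed B (+ suc i))   ≡⟨ signed-neg B* (signed B (+ suc i)) ⟩
    - signed B* (signed B (+ suc i))   ≡⟨ cong -_ (inverse-positive i) ⟩
    -[1+ i ]                           ∎
    where open ≡-Reasoning

finalFills-inverse : ∀ {n L} st st* → Realises n L st → Realises n (map swap L) st* →
  ∀ z → signed (finalFill n st*) (signed (finalFill n st) z) ≡ z
finalFills-inverse {L = L} (b , _) (b* , _) (R , refl) (R* , refl) rewrite values-swap L = Inverse.inverse R R*

wₙ-dual-inverse : ∀ τ → All PositiveBounds τ → ∀ n → budget 0 τ ≤ n →
  ∀ z → wₙ n (dual τ) (wₙ n τ z) ≡ z
wₙ-dual-inverse τ pos n within z = begin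
  wₙ n (dual τ) (wₙ n τ z)     ≡⟨ cong (wₙ n (dual τ)) (wₙ≡signed n τ z) ⟩
  wₙ n (dual τ) (signed B z)   ≡⟨ wₙ≡signed n (dual τ) (signed B z) ⟩
  signed B* (signed B z)       ≡⟨ finalFills-inverse (run n τ) (run n (dual τ)) realised realised* z ⟩
  z                            ∎
  where
  open ≡-Reasoning
  B B* : Board
  B = finalFill n (run n τ)
  B* = finalFill n (run n (dual τ))
  realised : Realises n (matching 0 τ []) (run n τ)
  realised = run-realises τ pos within
  realised* : Realises n (map swap (matching 0 τ [])) (run n (dual τ))
  realised* = subst (λ L → Realises n L (run n (dual τ))) (matching-dual 0 τ [])
                (run-realises (dual τ) (positive-dual pos) (subst (_≤ n) (sym (budget-dual 0 τ)) within))

lemma2p3 : (τ : List Column) → IsTriple τ →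
    Σ ℕ (λ N → (n : ℕ) → N ≤ n →
      ((z : ℤ) → wₙ n (dual τ) (wₙ n τ z) ≡ z) ×
      ((z : ℤ) → wₙ n τ (wₙ n (dual τ) z) ≡ z))
lemma2p3 τ triple = budget 0 τ , λ n within →
  wₙ-dual-inverse τ pos n within ,
  λ z → subst (λ σ → wₙ n σ (wₙ n (dual τ) z) ≡ z) (dual-involutive τ)
          (wₙ-dual-inverse (dual τ) (positive-dual pos) n (subst (_≤ n) (sym (budget-dual 0 τ)) within) z)
  where
  pos : All PositiveBounds τ
  pos = triple⇒positive τ triple
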